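{- Fix $n,s,b\in\mathbb{Z}^+$ with $1\le s\le n-1$. Let $D$ be the $s$-overlap transition digraph for the set of juggling sequences of period $n$ using at most $b$ balls. Then from any vertex $v_0v_1\ldots v_{s-1}$ of $D$ there exists a directed path in $D$ to any vertex $v_0'v_1'\ldots v_{s-1}'$ of $D$ satisfying $v_i'\equiv v_i \pmod n$ for all $i$.
   Context: A juggling sequence of period $n$ is a string $T=t_0\ldots t_{n-1}$ of integers $t_i\ge0$ such that $|\{i+t_i \bmod n: 0\le i\le n-1\}|=n$; its number of balls is $\frac1n\sum_{i=0}^{n-1}t_i$. For a set $\mathcal{C}$ of strings of length $n$, the $s$-overlap transition digraph is the directed multigraph whose vertices are the length-$s$ prefixes and length-$s$ suffixes of strings in $\mathcal{C}$, and which has, for each string $X\in\mathcal{C}$, one directed edge from the first $s$ letters of $X$ to the last $s$ letters of $X$. -}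

module Defs where

open import Data.Nat using (ℕ; _+_; _*_; _∸_; _≤_; NonZero)
open import Data.Nat.DivMod using (_%_)
open import Data.Fin using (Fin; toℕ)
open import Data.List using (List; length; lookup; take; drop)
open import Data.Nat.ListAction using (sum)
open import Data.List.Relation.Binary.Pointwise using (Pointwise)
open import Data.Product using (_×_; ∃)
open import Data.Sum using (_⊎_)
open import Relation.Binary.PropositionalEquality using (_≡_)

Str : Set
Str = List ℕ

IsJuggling : (n : ℕ) .{{_ : NonZero n}} → Str → Set
IsJuggling n t =
  length t ≡ n ×
  ((i j : Fin (length t)) →
     (toℕ i + lookup t i) % n ≡ (toℕ j + lookup t j) % n → i ≡ j)

-- The set C of juggling sequences of period n using at most b balls:
-- number of balls = (1/n) Σ t_i ≤ b, i.e. Σ t_i ≤ b·n.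
InC : (n b : ℕ) .{{_ : NonZero n}} → Str → Set
InC n b t = IsJuggling n t × sum t ≤ b * n

prefix : (s : ℕ) → Str → Str
prefix s t = take s t

suffix : (n s : ℕ) → Str → Str
suffix n s t = drop (n ∸ s) t

IsVertex : (n s b : ℕ) .{{_ : NonZero n}} → Str → Set
IsVertex n s b v = ∃ λ t → InC n b t × (prefix s t ≡ v ⊎ suffix n s t ≡ v)

-- Directed walks in D: each step traverses the edge of some X ∈ C, going
-- from prefix s X to suffix n s X.  (A walk exists iff a path exists.)
data Walk (n s b : ℕ) .{{_ : NonZero n}} : Str → Str → Set where
  here : ∀ {u} → Walk n s b u u
  step : ∀ {u w} (X : Str) → InC n b X → prefix s X ≡ u →
         Walk n s b (suffix n s X) w → Walk n s b u w

CongMod : (n : ℕ) .{{_ : NonZero n}} → Str → Str → Set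
CongMod n = Pointwise (λ x y → x % n ≡ y % n)

-- Every vertex of D is the initial length-s window of a periodic sequence f : ℕ → ℕ whose
-- length-n windows all lie in C, and walking along a sequence whose windows lie in C moves
-- the current length-s window forward by d = n − s per edge.  Whether a window is juggling
-- depends only on residues mod n, while replacing entries by smaller congruent ones only
-- lowers ball counts.  So the sequence that agrees with f below s and with g mod n above it
-- walks, after n·d ≥ s steps, from the window of f to that of g mod n; symmetrically one
-- walks from g mod n up to g.  Vertices congruent mod n come from sequences a and c that
-- are only congruent below s: splicing the first s residues of one into the other gives a
-- sequence congruent to the other, and one of the two splices a|c, c|a has at most b balls
-- because their ball counts add up to those of a and c.
module Submission where

open import Defs
open import Data.Bool using (if_then_else_)
open import Data.Fin using (Fin; toℕ; fromℕ<)
open import Data.Fin.Properties using (toℕ-injective; toℕ-fromℕ<; toℕ<n)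
open import Data.List using (List; []; _∷_; [_]; _∷ʳ_; length; lookup; take; drop; applyUpTo)
open import Data.List.Properties using (length-applyUpTo; lookup-applyUpTo; applyUpTo-∷ʳ)
open import Data.List.Relation.Binary.Pointwise using (Pointwise; _∷_)
open import Data.Nat using (ℕ; zero; suc; _+_; _*_; _∸_; _≤_; _<_; _≤?_; _<?_; NonZero; z<s; s<s; s≤s)
open import Data.Nat.DivMod
open import Data.Nat.ListAction using (sum)
open import Data.Nat.ListAction.Properties using (sum-++)
open import Data.Nat.Properties
open import Algebra.Properties.CommutativeSemigroup +-commutativeSemigroup using (interchange)
open import Data.Product using (∃; _×_; _,_; proj₁; proj₂)
open import Data.Sum using (_⊎_; inj₁; inj₂)
open import Function using (_∘_)
open import Relation.Binary.PropositionalEquality using (_≡_; refl; sym; trans; cong; cong₂; subst; subst₂; module ≡-Reasoning)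
open import Relation.Nullary using (Dec; yes; no; does; ¬_)
open import Relation.Nullary.Decidable using (dec-true; dec-false)

private
  variable
    A : Set

if-does-elim : ∀ {P : Set} (Q : A → Set) (p? : Dec P) {x y : A} →
  (P → Q x) → (¬ P → Q y) → Q (if does p? then x else y)
if-does-elim Q (yes p) qx _  = qx p
if-does-elim Q (no ¬p) _  qy = qy ¬p

+≤+⇒≤⊎≤ : ∀ {x y m m′} → x + y ≤ m + m′ → x ≤ m ⊎ y ≤ m′
+≤+⇒≤⊎≤ {x} {y} {m} {m′} le with x ≤? m
... | yes x≤m = inj₁ x≤m
... | no  x≰m = inj₂ (+-cancelˡ-≤ m y m′ (≤-trans (+-monoˡ-≤ y (<⇒≤ (≰⇒> x≰m))) le))

applyUpTo-cong : ∀ {f g : ℕ → A} L → (∀ {k} → k < L → f k ≡ g k) → applyUpTo f L ≡ applyUpTo g L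
applyUpTo-cong zero    _   = refl
applyUpTo-cong (suc L) f≗g = cong₂ _∷_ (f≗g z<s) (applyUpTo-cong L (f≗g ∘ s<s))

take-applyUpTo : ∀ (f : ℕ → A) {k L} → k ≤ L → take k (applyUpTo f L) ≡ applyUpTo f k
take-applyUpTo f {zero}          _         = refl
take-applyUpTo f {suc k} {suc L} (s≤s k≤L) = cong (f 0 ∷_) (take-applyUpTo (f ∘ suc) k≤L)

drop-applyUpTo : ∀ (f : ℕ → A) k L → drop k (applyUpTo f L) ≡ applyUpTo (λ i → f (k + i)) (L ∸ k)
drop-applyUpTo f zero    L       = refl
drop-applyUpTo f (suc k) zero    = refl
drop-applyUpTo f (suc k) (suc L) = drop-applyUpTo (f ∘ suc) k L

applyUpTo-Pointwise⁻ : ∀ {R : A → A → Set} {f g : ℕ → A} L →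
  Pointwise R (applyUpTo f L) (applyUpTo g L) → ∀ {k} → k < L → R (f k) (g k)
applyUpTo-Pointwise⁻ (suc L) (r ∷ _)  {zero}  _         = r
applyUpTo-Pointwise⁻ (suc L) (_ ∷ rs) {suc k} (s<s k<L) = applyUpTo-Pointwise⁻ L rs k<L

sum-applyUpTo-mono : ∀ {f g : ℕ → ℕ} L → (∀ {k} → k < L → f k ≤ g k) →
  sum (applyUpTo f L) ≤ sum (applyUpTo g L)
sum-applyUpTo-mono zero    _   = ≤-refl
sum-applyUpTo-mono (suc L) f≤g = +-mono-≤ (f≤g z<s) (sum-applyUpTo-mono L (f≤g ∘ s<s))

sum-applyUpTo-+ : ∀ (f g : ℕ → ℕ) L →
  sum (applyUpTo (λ i → f i + g i) L) ≡ sum (applyUpTo f L) + sum (applyUpTo g L)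
sum-applyUpTo-+ f g zero    = refl
sum-applyUpTo-+ f g (suc L) = begin
  f 0 + g 0 + sum (applyUpTo (λ i → f (suc i) + g (suc i)) L)
    ≡⟨ cong (f 0 + g 0 +_) (sum-applyUpTo-+ (f ∘ suc) (g ∘ suc) L) ⟩
  f 0 + g 0 + (sum (applyUpTo (f ∘ suc) L) + sum (applyUpTo (g ∘ suc) L))
    ≡⟨ interchange (f 0) (g 0) _ _ ⟩
  sum (applyUpTo f (suc L)) + sum (applyUpTo g (suc L)) ∎
  where open ≡-Reasoning

sum-applyUpTo-rotate : ∀ (f : ℕ → ℕ) L →
  sum (applyUpTo (f ∘ suc) L) + f 0 ≡ sum (applyUpTo f L) + f L
sum-applyUpTo-rotate f L = begin
  sum (applyUpTo (f ∘ suc) L) + f 0     ≡⟨ +-comm _ (f 0) ⟩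
  sum (applyUpTo f (suc L))             ≡⟨ cong sum (applyUpTo-∷ʳ f L) ⟨
  sum (applyUpTo f L ∷ʳ f L)            ≡⟨ sum-++ (applyUpTo f L) [ f L ] ⟩
  sum (applyUpTo f L) + (f L + 0)       ≡⟨ cong (sum (applyUpTo f L) +_) (+-identityʳ (f L)) ⟩
  sum (applyUpTo f L) + f L             ∎
  where open ≡-Reasoning

-- Total indexing, with junk value 0 past the end.
nth : List ℕ → ℕ → ℕ
nth []       _       = 0
nth (x ∷ _)  zero    = x
nth (_ ∷ xs) (suc i) = nth xs i

applyUpTo-nth : ∀ xs → applyUpTo (nth xs) (length xs) ≡ xs
applyUpTo-nth []       = refl
applyUpTo-nth (x ∷ xs) = cong (x ∷_) (applyUpTo-nth xs)

shift : ℕ → (ℕ → A) → ℕ → A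
shift p f i = f (p + i)

module _ {n : ℕ} .{{_ : NonZero n}} where

  +-congˡ-% : ∀ c {a a′} → a % n ≡ a′ % n → (c + a) % n ≡ (c + a′) % n
  +-congˡ-% c {a} {a′} eq = begin
    (c + a) % n                ≡⟨ %-distribˡ-+ c a n ⟩
    (c % n + a % n) % n        ≡⟨ cong (λ r → (c % n + r) % n) eq ⟩
    (c % n + a′ % n) % n       ≡⟨ %-distribˡ-+ c a′ n ⟨
    (c + a′) % n               ∎
    where open ≡-Reasoning

  +-congʳ-% : ∀ c {a a′} → a % n ≡ a′ % n → (a + c) % n ≡ (a′ + c) % n
  +-congʳ-% c {a} {a′} eq = begin
    (a + c) % n   ≡⟨ cong (_% n) (+-comm a c) ⟩
    (c + a) % n   ≡⟨ +-congˡ-% c eq ⟩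
    (c + a′) % n  ≡⟨ cong (_% n) (+-comm c a′) ⟩
    (a′ + c) % n  ∎
    where open ≡-Reasoning

  +-cancelˡ-% : ∀ p {i j} → (p + i) % n ≡ (p + j) % n → i % n ≡ j % n
  +-cancelˡ-% p {i} {j} eq = trans (sym (undo i)) (trans (+-congˡ-% (n ∸ p % n) eq) (undo j))
    where
    open ≡-Reasoning
    undo : ∀ x → (n ∸ p % n + (p + x)) % n ≡ x % n
    undo x = begin
      (n ∸ p % n + (p + x)) % n      ≡⟨ +-congˡ-% (n ∸ p % n) (+-congʳ-% x (sym (m%n%n≡m%n p n))) ⟩
      (n ∸ p % n + (p % n + x)) % n  ≡⟨ cong (_% n) (+-assoc (n ∸ p % n) (p % n) x) ⟨
      (n ∸ p % n + p % n + x) % n    ≡⟨ cong (λ m → (m + x) % n) (m∸n+n≡m (m%n≤n p n)) ⟩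
      (n + x) % n                    ≡⟨ cong (_% n) (+-comm n x) ⟩
      (x + n) % n                    ≡⟨ [m+n]%n≡m%n x n ⟩
      x % n                          ∎

module Juggling (n b : ℕ) .{{_ : NonZero n}} where

  Periodic : (ℕ → ℕ) → Set
  Periodic f = ∀ i → f (i + n) ≡ f i

  Congruent : (ℕ → ℕ) → (ℕ → ℕ) → Set
  Congruent f g = ∀ i → f i % n ≡ g i % n

  Juggles : (ℕ → ℕ) → Set
  Juggles f = ∀ {i j} → i < n → j < n → (i + f i) % n ≡ (j + f j) % n → i ≡ j

  Bounded : (ℕ → ℕ) → Set
  Bounded f = sum (applyUpTo f n) ≤ b * n

  IsEdge : (ℕ → ℕ) → Set
  IsEdge f = Juggles f × Bounded f

  Admissible : (ℕ → ℕ) → Set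
  Admissible f = Periodic f × IsEdge f

  isEdge⇒InC : ∀ {f} → IsEdge f → InC n b (applyUpTo f n)
  isEdge⇒InC {f} (juggles , bounded) = (length-applyUpTo f n , injective) , bounded
    where
    index< : (i : Fin (length (applyUpTo f n))) → toℕ i < n
    index< i = subst (toℕ i <_) (length-applyUpTo f n) (toℕ<n i)
    injective : ∀ i j → (toℕ i + lookup (applyUpTo f n) i) % n ≡ (toℕ j + lookup (applyUpTo f n) j) % n →
                i ≡ j
    injective i j eq = toℕ-injective (juggles (index< i) (index< j)
      (subst₂ (λ x y → (toℕ i + x) % n ≡ (toℕ j + y) % n)
        (lookup-applyUpTo f n i) (lookup-applyUpTo f n j) eq))

  InC⇒isEdge : ∀ {f} → InC n b (applyUpTo f n) → IsEdge f
  InC⇒isEdge {f} ((_ , injective) , bounded) = juggles , bounded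
    where
    index : ∀ {i} → i < n → Fin (length (applyUpTo f n))
    index {i} i<n = fromℕ< (subst (i <_) (sym (length-applyUpTo f n)) i<n)
    entry : ∀ {i} (i<n : i < n) → toℕ (index i<n) + lookup (applyUpTo f n) (index i<n) ≡ i + f i
    entry i<n = cong₂ _+_ (toℕ-fromℕ< _)
      (trans (lookup-applyUpTo f n (index i<n)) (cong f (toℕ-fromℕ< _)))
    juggles : Juggles f
    juggles i<n j<n eq = begin
      _                  ≡⟨ toℕ-fromℕ< _ ⟨
      toℕ (index i<n)    ≡⟨ cong toℕ (injective (index i<n) (index j<n)
                             (trans (cong (_% n) (entry i<n)) (trans eq (cong (_% n) (sym (entry j<n)))))) ⟩
      toℕ (index j<n)    ≡⟨ toℕ-fromℕ< _ ⟩
      _                  ∎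
      where open ≡-Reasoning

  juggles-congruent : ∀ {f g} → Juggles f → Congruent g f → Juggles g
  juggles-congruent juggles g≅f {i} {j} i<n j<n eq =
    juggles i<n j<n (trans (sym (+-congˡ-% i (g≅f i))) (trans eq (+-congˡ-% j (g≅f j))))

  module _ {f : ℕ → ℕ} (periodic : Periodic f) where

    periodic-+* : ∀ k i → f (i + k * n) ≡ f i
    periodic-+* zero    i = cong f (+-identityʳ i)
    periodic-+* (suc k) i = begin
      f (i + (n + k * n))  ≡⟨ cong f (trans (cong (i +_) (+-comm n (k * n))) (sym (+-assoc i (k * n) n))) ⟩
      f (i + k * n + n)    ≡⟨ periodic (i + k * n) ⟩
      f (i + k * n)        ≡⟨ periodic-+* k i ⟩
      f i                  ∎
      where open ≡-Reasoning

    periodic-% : ∀ i → f i ≡ f (i % n)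
    periodic-% i = trans (cong f (m≡m%n+[m/n]*n i n)) (periodic-+* (i / n) (i % n))

    shift-periodic : ∀ p → Periodic (shift p f)
    shift-periodic p i = trans (cong f (sym (+-assoc p i n))) (periodic (p + i))

    juggles-shift : Juggles f → ∀ p → Juggles (shift p f)
    juggles-shift juggles p {i} {j} i<n j<n eq =
      m%n≡m⇒≡ (+-cancelˡ-% p (juggles (m%n<n (p + i) n) (m%n<n (p + j) n) (begin
        ((p + i) % n + f ((p + i) % n)) % n  ≡⟨ reduce-index (p + i) ⟩
        (p + i + f (p + i)) % n              ≡⟨ cong (_% n) (+-assoc p i _) ⟩
        (p + (i + f (p + i))) % n            ≡⟨ +-congˡ-% p eq ⟩
        (p + (j + f (p + j))) % n            ≡⟨ cong (_% n) (+-assoc p j _) ⟨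
        (p + j + f (p + j)) % n              ≡⟨ reduce-index (p + j) ⟨
        ((p + j) % n + f ((p + j) % n)) % n  ∎)))
      where
      open ≡-Reasoning
      reduce-index : ∀ x → (x % n + f (x % n)) % n ≡ (x + f x) % n
      reduce-index x = trans (cong (λ y → (x % n + y) % n) (sym (periodic-% x)))
                             (+-congʳ-% (f x) (m%n%n≡m%n x n))
      m%n≡m⇒≡ : i % n ≡ j % n → i ≡ j
      m%n≡m⇒≡ eq′ = trans (sym (m<n⇒m%n≡m i<n)) (trans eq′ (m<n⇒m%n≡m j<n))

  sum-shift : ∀ {f} → Periodic f → ∀ p → sum (applyUpTo (shift p f) n) ≡ sum (applyUpTo f n)
  sum-shift         periodic zero    = refl
  sum-shift {f = f} periodic (suc p) = trans (sum-shift (periodic ∘ suc) p)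
    (+-cancelʳ-≡ (f 0) _ _ (trans (sum-applyUpTo-rotate f n) (cong (sum (applyUpTo f n) +_) (periodic 0))))

  shift-admissible : ∀ {f} → Admissible f → ∀ p → Admissible (shift p f)
  shift-admissible (periodic , juggles , bounded) p =
    shift-periodic periodic p ,
    juggles-shift periodic juggles p ,
    subst (_≤ b * n) (sym (sum-shift periodic p)) bounded

  dominated-isEdge : ∀ {f g} → IsEdge f → (∀ i → g i ≤ f i) → Congruent g f → IsEdge g
  dominated-isEdge (juggles , bounded) g≤f g≅f =
    juggles-congruent juggles g≅f , ≤-trans (sum-applyUpTo-mono n (λ {i} _ → g≤f i)) bounded

  cycle : Str → ℕ → ℕ
  cycle T i = nth T (i % n)

  applyUpTo-cycle : ∀ T → length T ≡ n → applyUpTo (cycle T) n ≡ T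
  applyUpTo-cycle T |T|≡n = trans (applyUpTo-cong n (cong (nth T) ∘ m<n⇒m%n≡m))
    (subst (λ L → applyUpTo (nth T) L ≡ T) |T|≡n (applyUpTo-nth T))

  cycle-admissible : ∀ T → InC n b T → Admissible (cycle T)
  cycle-admissible T T∈C@((|T|≡n , _) , _) =
    (λ i → cong (nth T) ([m+n]%n≡m%n i n)) ,
    InC⇒isEdge (subst (InC n b) (sym (applyUpTo-cycle T |T|≡n)) T∈C)

  module Overlap (s : ℕ) (s<n : s < n) where

    private
      d : ℕ
      d = n ∸ s

      s≤n : s ≤ n
      s≤n = <⇒≤ s<n

    _⇝_ : Str → Str → Set
    _⇝_ = Walk n s b

    walk-trans : ∀ {u v w} → u ⇝ v → v ⇝ w → u ⇝ w
    walk-trans here               v⇝w = v⇝w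
    walk-trans (step X X∈C p u⇝v) v⇝w = step X X∈C p (walk-trans u⇝v v⇝w)

    suffix-applyUpTo : ∀ f p → suffix n s (applyUpTo (shift p f) n) ≡ applyUpTo (shift (p + d) f) s
    suffix-applyUpTo f p = begin
      drop d (applyUpTo (shift p f) n)               ≡⟨ drop-applyUpTo (shift p f) d n ⟩
      applyUpTo (λ i → f (p + (d + i))) (n ∸ d)      ≡⟨ cong (applyUpTo _) (m∸[m∸n]≡n s≤n) ⟩
      applyUpTo (λ i → f (p + (d + i))) s
        ≡⟨ applyUpTo-cong s (λ {i} _ → cong f (sym (+-assoc p d i))) ⟩
      applyUpTo (shift (p + d) f) s                  ∎
      where open ≡-Reasoning

    walk-along : ∀ {f} → (∀ p → IsEdge (shift p f)) →
      ∀ K p → applyUpTo (shift p f) s ⇝ applyUpTo (shift (p + K * d) f) s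
    walk-along {f} _ zero p =
      subst (λ q → applyUpTo (shift p f) s ⇝ applyUpTo (shift q f) s) (sym (+-identityʳ p)) here
    walk-along {f} edges (suc K) p =
      step (applyUpTo (shift p f) n) (isEdge⇒InC (edges p)) (take-applyUpTo (shift p f) s≤n)
        (subst₂ _⇝_ (sym (suffix-applyUpTo f p)) (cong (λ q → applyUpTo (shift q f) s) (+-assoc p d (K * d)))
          (walk-along {f} edges K (p + d)))

    cut : (ℕ → ℕ) → (ℕ → ℕ) → ℕ → ℕ
    cut u w i = if does (i <? s) then u i else w i

    -- A walk is forced to advance by d ≥ 1 per edge, so n·d steps leave the first s
    -- positions behind while returning to the same phase mod n.
    walk-via-cut : ∀ {h u w} → Admissible h → Periodic w →
      (∀ i → u i ≤ h i) → (∀ i → w i ≤ h i) → Congruent u h → Congruent w h →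
      applyUpTo u s ⇝ applyUpTo w s
    walk-via-cut {h} {u} {w} h-admissible w-periodic u≤h w≤h u≅h w≅h =
      subst₂ _⇝_ start end (walk-along edges n 0)
      where
      edges : ∀ p → IsEdge (shift p (cut u w))
      edges p = dominated-isEdge (proj₂ (shift-admissible h-admissible p))
        (λ i → if-does-elim (_≤ h (p + i)) (p + i <? s) (λ _ → u≤h (p + i)) (λ _ → w≤h (p + i)))
        (λ i → if-does-elim (λ x → x % n ≡ h (p + i) % n) (p + i <? s)
                 (λ _ → u≅h (p + i)) (λ _ → w≅h (p + i)))
      start : applyUpTo (cut u w) s ≡ applyUpTo u s
      start = applyUpTo-cong s λ {i} i<s → cong (if_then u i else w i) (dec-true (i <? s) i<s)
      s≤nd : s ≤ n * d
      s≤nd = ≤-trans s≤n (subst (_≤ n * d) (*-identityʳ n) (*-monoʳ-≤ n (m<n⇒0<n∸m s<n)))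
      end : applyUpTo (shift (n * d) (cut u w)) s ≡ applyUpTo w s
      end = applyUpTo-cong s λ {i} _ → begin
        cut u w (n * d + i)  ≡⟨ cong (if_then u (n * d + i) else w (n * d + i))
                                  (dec-false (n * d + i <? s) (≤⇒≯ (≤-trans s≤nd (m≤m+n (n * d) i)))) ⟩
        w (n * d + i)        ≡⟨ cong w (trans (+-comm (n * d) i) (cong (i +_) (*-comm n d))) ⟩
        w (i + d * n)        ≡⟨ periodic-+* w-periodic d i ⟩
        w i                  ∎
        where open ≡-Reasoning

    walk-congruent : ∀ {f g} → Admissible f → Admissible g → Congruent f g →
      applyUpTo f s ⇝ applyUpTo g s
    walk-congruent {f} {g} f-admissible g-admissible f≅g = walk-trans
      (walk-via-cut f-admissible (λ i → cong (_% n) (proj₁ g-admissible i))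
        (λ _ → ≤-refl) (λ i → subst (_≤ f i) (f≅g i) (m%n≤m (f i) n))
        (λ _ → refl) (λ i → trans (m%n%n≡m%n (g i) n) (sym (f≅g i))))
      (walk-via-cut g-admissible (proj₁ g-admissible)
        (λ i → m%n≤m (g i) n) (λ _ → ≤-refl)
        (λ i → m%n%n≡m%n (g i) n) (λ _ → refl))

    splice : (ℕ → ℕ) → (ℕ → ℕ) → ℕ → ℕ
    splice a c i = if does (i % n <? s) then a i else c i

    splice-periodic : ∀ {a c} → Periodic a → Periodic c → Periodic (splice a c)
    splice-periodic {a} {c} a-periodic c-periodic i = trans
      (cong (λ r → if does (r <? s) then a (i + n) else c (i + n)) ([m+n]%n≡m%n i n))
      (cong₂ (if does (i % n <? s) then_else_) (a-periodic i) (c-periodic i))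

    applyUpTo-splice : ∀ a c → applyUpTo (splice a c) s ≡ applyUpTo a s
    applyUpTo-splice a c = applyUpTo-cong s λ {k} k<s →
      cong (if_then a k else c k)
        (trans (cong (does ∘ (_<? s)) (m<n⇒m%n≡m (<-trans k<s s<n))) (dec-true (k <? s) k<s))

    splice-congruent : ∀ {a c} → Periodic a → Periodic c → (∀ {k} → k < s → a k % n ≡ c k % n) →
      Congruent (splice a c) c
    splice-congruent {a} {c} a-periodic c-periodic a≅c i =
      if-does-elim (λ x → x % n ≡ c i % n) (i % n <? s) residue-below (λ _ → refl)
      where
      open ≡-Reasoning
      residue-below : i % n < s → a i % n ≡ c i % n
      residue-below i<s = begin
        a i % n          ≡⟨ cong (_% n) (periodic-% a-periodic i) ⟩
        a (i % n) % n    ≡⟨ a≅c i<s ⟩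
        c (i % n) % n    ≡⟨ cong (_% n) (periodic-% c-periodic i) ⟨
        c i % n          ∎

    splice-admissible : ∀ {a c} → Admissible a → Admissible c →
      (∀ {k} → k < s → a k % n ≡ c k % n) → Bounded (splice a c) → Admissible (splice a c)
    splice-admissible (a-periodic , _) (c-periodic , c-juggles , _) a≅c bounded =
      splice-periodic a-periodic c-periodic ,
      juggles-congruent c-juggles (splice-congruent a-periodic c-periodic a≅c) ,
      bounded

    splice-+-swap : ∀ a c i → splice a c i + splice c a i ≡ a i + c i
    splice-+-swap a c i = if-does-elim (λ x → x + splice c a i ≡ a i + c i) (i % n <? s)
      (λ i<s → cong (a i +_) (cong (if_then c i else a i) (dec-true (i % n <? s) i<s)))
      (λ i≮s → trans (cong (c i +_) (cong (if_then c i else a i) (dec-false (i % n <? s) i≮s)))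
                     (+-comm (c i) (a i)))

    splice-bounded : ∀ {a c} → Bounded a → Bounded c → Bounded (splice a c) ⊎ Bounded (splice c a)
    splice-bounded {a} {c} a-bounded c-bounded = +≤+⇒≤⊎≤ (begin
      sum (applyUpTo (splice a c) n) + sum (applyUpTo (splice c a) n)
        ≡⟨ sum-applyUpTo-+ (splice a c) (splice c a) n ⟨
      sum (applyUpTo (λ i → splice a c i + splice c a i) n)
        ≡⟨ cong sum (applyUpTo-cong n (λ {i} _ → splice-+-swap a c i)) ⟩
      sum (applyUpTo (λ i → a i + c i) n)
        ≡⟨ sum-applyUpTo-+ a c n ⟩
      sum (applyUpTo a n) + sum (applyUpTo c n)
        ≤⟨ +-mono-≤ a-bounded c-bounded ⟩
      b * n + b * n ∎)
      where open ≤-Reasoning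

    vertex-admissible : ∀ {v} → IsVertex n s b v → ∃ λ f → Admissible f × applyUpTo f s ≡ v
    vertex-admissible (T , T∈C@((|T|≡n , _) , _) , inj₁ prefix≡v) =
      cycle T , cycle-admissible T T∈C ,
      trans (sym (take-applyUpTo (cycle T) s≤n)) (trans (cong (take s) (applyUpTo-cycle T |T|≡n)) prefix≡v)
    vertex-admissible (T , T∈C@((|T|≡n , _) , _) , inj₂ suffix≡v) =
      shift d (cycle T) , shift-admissible (cycle-admissible T T∈C) d ,
      trans (sym (suffix-applyUpTo (cycle T) 0)) (trans (cong (drop d) (applyUpTo-cycle T |T|≡n)) suffix≡v)

    walk-between-vertices : ∀ {v v′} → IsVertex n s b v → IsVertex n s b v′ →
      CongMod n v v′ → v ⇝ v′
    walk-between-vertices v∈D v′∈D v≅v′ with vertex-admissible v∈D | vertex-admissible v′∈D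
    ... | a , a-admissible , refl | c , c-admissible , refl
      with splice-bounded (proj₂ (proj₂ a-admissible)) (proj₂ (proj₂ c-admissible))
    ... | inj₁ ac-bounded =
      subst (_⇝ applyUpTo c s) (applyUpTo-splice a c)
        (walk-congruent (splice-admissible a-admissible c-admissible a≅c ac-bounded) c-admissible
          (splice-congruent (proj₁ a-admissible) (proj₁ c-admissible) a≅c))
      where
      a≅c : ∀ {k} → k < s → a k % n ≡ c k % n
      a≅c = applyUpTo-Pointwise⁻ s v≅v′
    ... | inj₂ ca-bounded =
      subst (applyUpTo a s ⇝_) (applyUpTo-splice c a)
        (walk-congruent a-admissible (splice-admissible c-admissible a-admissible c≅a ca-bounded)
          (sym ∘ splice-congruent (proj₁ c-admissible) (proj₁ a-admissible) c≅a))
      where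
      c≅a : ∀ {k} → k < s → c k % n ≡ a k % n
      c≅a = sym ∘ applyUpTo-Pointwise⁻ s v≅v′

mainTheorem8 : (n s b : ℕ) .{{_ : NonZero n}} → 1 ≤ s → s ≤ n ∸ 1 → 1 ≤ b →
    (v v′ : Str) → IsVertex n s b v → IsVertex n s b v′ → CongMod n v v′ →
    Walk n s b v v′
mainTheorem8 (suc n) s b _ s≤n _ _ _ =
  Juggling.Overlap.walk-between-vertices (suc n) b s (s≤s s≤n)
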